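{- Let $N$ be a neuron, $\mathit{inp}$ a list of input functions and $len\in\mathbb{N}$. If $N$ is initial and $w_N(id)\le 0$ for every $id<len$, then every element of $Output_N(\mathit{inp},len)$ equals $0$.
   Context: Booleans are identified with $0$ (false) and $1$ (true). A neuron $N$ consists of an identifier $id_N\in\mathbb{N}$, a weight function $w_N:\mathbb{N}\to\mathbb{Q}$ with $-1\le w_N(x)\le 1$ for all $x$ and $w_N(id_N)=0$, a leak factor $lk_N\in\mathbb{Q}$ with $0\le lk_N\le 1$, a threshold $\tau_N\in\mathbb{Q}$ with $\tau_N>0$, an output list $Output(N)$ of booleans (most recent first) and a current potential $CurPot(N)\in\mathbb{Q}$, subject to: $(\tau_N\le CurPot(N))$ equals the head of $Output(N)$ (the head of an empty list being $0$). An input function is a map $i:\mathbb{N}\to\{0,1\}$; $potential(w,i,len)=\sum_{0\le k<len,\ i(k)=1} w(k)$. The one-step update of $N$ with input function $i$ in an environment of $len$ neurons keeps $id,w,lk,\tau$, sets the new potential $p=potential(w_N,i,len)$ if $\tau_N\le CurPot(N)$ and $p=potential(w_N,i,len)+lk_N\cdot CurPot(N)$ otherwise, and sets the new output list to $(\tau_N\le p)::Output(N)$. For a list of input functions (most recent first), $AfterNsteps(N,[\,],len)=N$ and $AfterNsteps(N,i::\mathit{inp},len)$ is the one-step update of $AfterNsteps(N,\mathit{inp},len)$ with $i$; $Output_N(\mathit{inp},len)$ denotes its output list. $N$ is initial if $Output(N)=[0]$ and $CurPot(N)=0$. -}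

module Defs where

open import Data.Bool using (Bool; true; false; if_then_else_)
open import Data.Nat as ℕ using (ℕ; zero; suc)
open import Data.Rational using (ℚ; 0ℚ; 1ℚ; _+_; _*_; _≤_; _<_; _≤ᵇ_; -_)
open import Data.List using (List; []; _∷_)
open import Relation.Binary.PropositionalEquality using (_≡_)

-- head of a boolean list, the head of the empty list being false (= 0)
headB : List Bool → Bool
headB []      = false
headB (b ∷ _) = b

record Neuron : Set where
  constructor mkNeuron
  field
    id      : ℕ
    w       : ℕ → ℚ
    lk      : ℚ
    τ       : ℚ
    Output  : List Bool
    CurPot  : ℚ
    w-lower : ∀ x → - 1ℚ ≤ w x
    w-upper : ∀ x → w x ≤ 1ℚ
    w-self  : w id ≡ 0ℚ
    lk-lower : 0ℚ ≤ lk
    lk-upper : lk ≤ 1ℚ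
    τ-pos   : 0ℚ < τ
    consistent : (τ ≤ᵇ CurPot) ≡ headB Output

open Neuron public

Input : Set
Input = ℕ → Bool

potential : (ℕ → ℚ) → Input → ℕ → ℚ
potential w i zero    = 0ℚ
potential w i (suc k) = potential w i k + (if i k then w k else 0ℚ)

nextPot : Neuron → Input → ℕ → ℚ
nextPot N i len =
  if τ N ≤ᵇ CurPot N
  then potential (w N) i len
  else potential (w N) i len + lk N * CurPot N

NextNeuron : Neuron → Input → ℕ → Neuron
NextNeuron N i len = record
  { id = id N ; w = w N ; lk = lk N ; τ = τ N
  ; Output = (τ N ≤ᵇ nextPot N i len) ∷ Output N
  ; CurPot = nextPot N i len
  ; w-lower = w-lower N ; w-upper = w-upper N ; w-self = w-self N
  ; lk-lower = lk-lower N ; lk-upper = lk-upper N ; τ-pos = τ-pos N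
  ; consistent = Relation.Binary.PropositionalEquality.refl
  }

-- input lists are most recent first
AfterNsteps : Neuron → List Input → ℕ → Neuron
AfterNsteps N []        len = N
AfterNsteps N (i ∷ inp) len = NextNeuron (AfterNsteps N inp len) i len

OutputN : Neuron → List Input → ℕ → List Bool
OutputN N inp len = Output (AfterNsteps N inp len)

Initial : Neuron → Set
Initial N = (Output N ≡ false ∷ []) × (CurPot N ≡ 0ℚ)
  where open import Data.Product using (_×_)

{-# OPTIONS --safe #-}
module Submission where

-- A neuron whose incoming weights are all non-positive can never build up a
-- positive potential: the weighted input sum is non-positive, and the leaked
-- part lk · CurPot is a non-negative multiple of a non-positive potential.
-- Since τ > 0, the neuron never fires, and both facts survive every update.

open import Defs
open import Data.Nat using (ℕ; _<_; zero; suc)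
open import Data.Nat.Properties using (m<n⇒m<1+n; n<1+n)
open import Data.Bool using (true; false; T; if_then_else_)
open import Data.List using (List; []; _∷_)
open import Data.List.Relation.Unary.All using (All; []; _∷_)
open import Data.Rational using (ℚ; 0ℚ; _+_; _*_; _≤ᵇ_; nonNegative) renaming (_≤_ to _≤ℚ_; _<_ to _<ℚ_)
open import Data.Rational.Properties using (≤-refl; ≤-<-trans; <-≤-trans; <-irrefl; ≤ᵇ⇒≤; +-mono-≤; +-identityʳ; *-monoˡ-≤-nonNeg; *-zeroʳ)
open import Data.Product using (_,_)
open import Relation.Nullary using (contradiction)
open import Relation.Binary.PropositionalEquality using (_≡_; refl; sym; subst)

+-nonPos : ∀ {p q} → p ≤ℚ 0ℚ → q ≤ℚ 0ℚ → p + q ≤ℚ 0ℚ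
+-nonPos {p} {q} p≤0 q≤0 = subst (p + q ≤ℚ_) (+-identityʳ 0ℚ) (+-mono-≤ p≤0 q≤0)

nonNeg*nonPos≤0 : ∀ {p q} → 0ℚ ≤ℚ p → q ≤ℚ 0ℚ → p * q ≤ℚ 0ℚ
nonNeg*nonPos≤0 {p} {q} 0≤p q≤0 =
  subst (p * q ≤ℚ_) (*-zeroʳ p) (*-monoˡ-≤-nonNeg p {{nonNegative 0≤p}} q≤0)

<⇒≤ᵇ≡false : ∀ {p q} → q <ℚ p → (p ≤ᵇ q) ≡ false
<⇒≤ᵇ≡false {p} {q} q<p with p ≤ᵇ q in p≤ᵇq
... | false = refl
... | true  = contradiction (<-≤-trans q<p (≤ᵇ⇒≤ (subst T (sym p≤ᵇq) _))) (<-irrefl refl)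

Inhibitory : (ℕ → ℚ) → ℕ → Set
Inhibitory w len = ∀ k → k < len → w k ≤ℚ 0ℚ

potential-nonPos : ∀ {w} i len → Inhibitory w len → potential w i len ≤ℚ 0ℚ
potential-nonPos i zero    _   = ≤-refl
potential-nonPos {w} i (suc n) inh =
  +-nonPos (potential-nonPos i n (λ k k<n → inh k (m<n⇒m<1+n k<n))) input≤0
  where
  input≤0 : (if i n then w n else 0ℚ) ≤ℚ 0ℚ
  input≤0 with i n
  ... | true  = inh n (n<1+n n)
  ... | false = ≤-refl

nextPot-nonPos : ∀ N i len → Inhibitory (w N) len → CurPot N ≤ℚ 0ℚ → nextPot N i len ≤ℚ 0ℚ
nextPot-nonPos N i len inh pot≤0 with τ N ≤ᵇ CurPot N
... | true  = potential-nonPos i len inh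
... | false = +-nonPos (potential-nonPos i len inh) (nonNeg*nonPos≤0 (lk-lower N) pot≤0)

record Silent (len : ℕ) (N : Neuron) : Set where
  field
    inhibitory : Inhibitory (w N) len
    curPot≤0   : CurPot N ≤ℚ 0ℚ
    neverFired : All (_≡ false) (Output N)

initial⇒silent : ∀ {N len} → Initial N → Inhibitory (w N) len → Silent len N
initial⇒silent (out≡[0] , pot≡0) inh = record
  { inhibitory = inh
  ; curPot≤0   = subst (_≤ℚ 0ℚ) (sym pot≡0) ≤-refl
  ; neverFired = subst (All (_≡ false)) (sym out≡[0]) (refl ∷ [])
  }

NextNeuron-silent : ∀ {N len} i → Silent len N → Silent len (NextNeuron N i len)
NextNeuron-silent {N} {len} i silent = record
  { inhibitory = inhibitory
  ; curPot≤0   = next≤0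
  ; neverFired = <⇒≤ᵇ≡false (≤-<-trans next≤0 (τ-pos N)) ∷ neverFired
  }
  where
  open Silent silent
  next≤0 : nextPot N i len ≤ℚ 0ℚ
  next≤0 = nextPot-nonPos N i len inhibitory curPot≤0

AfterNsteps-silent : ∀ {N len} inp → Silent len N → Silent len (AfterNsteps N inp len)
AfterNsteps-silent []        silent = silent
AfterNsteps-silent (i ∷ inp) silent = NextNeuron-silent i (AfterNsteps-silent inp silent)

lemma4p2 : (N : Neuron) (inp : List Input) (len : ℕ) →
    Initial N →
    (∀ k → k < len → w N k ≤ℚ 0ℚ) →
    All (λ b → b ≡ false) (OutputN N inp len)
lemma4p2 N inp len initial inh =
  Silent.neverFired (AfterNsteps-silent inp (initial⇒silent initial inh))
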